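{- Let $D$ be a bipartite tournament with bipartition $(V_1,V_2)$, and let $uv$ be an edge of $C_{1,2}(D)$ with $u\in V_1$ and $v\in V_2$. Then, in $C_{1,2}(D)$, $u$ has a neighbor in $V_1$ or $v$ has a neighbor in $V_2$.
   Context: A bipartite tournament is an orientation of a complete bipartite graph $K_{m,n}$ ($m,n\ge1$). For vertices $x,y$ of a digraph $H$, $d_H(x,y)$ is the length of a shortest directed $(x,y)$-path. The $(1,2)$-step competition graph $C_{1,2}(D)$ is the simple graph on $V(D)$ in which distinct $u,v$ are adjacent iff there is $w\neq u,v$ with either $d_{D-v}(u,w)\le 1$ and $d_{D-u}(v,w)\le 2$, or $d_{D-u}(v,w)\le 1$ and $d_{D-v}(u,w)\le 2$. -}

module Defs where

open import Data.Nat using (ℕ)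
open import Data.Fin using (Fin)
open import Data.Bool using (Bool; true; false)
open import Data.Sum using (_⊎_; inj₁; inj₂)
open import Data.Product using (_×_; ∃-syntax)
open import Data.Empty using (⊥)
open import Relation.Binary.PropositionalEquality using (_≡_; _≢_)

-- The parts are
-- V₁ = Fin m and V₂ = Fin n; vertices of D are  Fin m ⊎ Fin n
-- (inj₁ = V₁, inj₂ = V₂).  For a ∈ V₁, b ∈ V₂, the edge ab is oriented
-- a → b iff  orient a b ≡ true, and b → a iff  orient a b ≡ false.
BipTournament : ℕ → ℕ → Set
BipTournament m n = Fin m → Fin n → Bool

Vtx : ℕ → ℕ → Set
Vtx m n = Fin m ⊎ Fin n

Arc : ∀ {m n} → BipTournament m n → Vtx m n → Vtx m n → Set
Arc D (inj₁ a) (inj₂ b) = D a b ≡ true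
Arc D (inj₂ b) (inj₁ a) = D a b ≡ false
Arc D (inj₁ _) (inj₁ _) = ⊥
Arc D (inj₂ _) (inj₂ _) = ⊥

-- d_{D - z}(x, y) ≤ 1, for vertices x, y of D - z (i.e. x, y ≠ z).
Dist≤1 : ∀ {m n} → BipTournament m n → (z x y : Vtx m n) → Set
Dist≤1 D z x y = x ≢ z × y ≢ z × (x ≡ y ⊎ Arc D x y)

-- d_{D - z}(x, y) ≤ 2: a directed (x,y)-path of length ≤ 2 in D - z.
Dist≤2 : ∀ {m n} → BipTournament m n → (z x y : Vtx m n) → Set
Dist≤2 D z x y =
  Dist≤1 D z x y ⊎
  (x ≢ z × y ≢ z × ∃[ t ] (t ≢ z × Arc D x t × Arc D t y))

C12Adj : ∀ {m n} → BipTournament m n → Vtx m n → Vtx m n → Set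
C12Adj D u v =
  u ≢ v ×
  ∃[ w ] (w ≢ u × w ≢ v ×
    ((Dist≤1 D v u w × Dist≤2 D u v w) ⊎
     (Dist≤1 D u v w × Dist≤2 D v u w)))

module Submission where

open import Defs
open import Data.Nat using (ℕ)
open import Data.Fin using (Fin)
open import Data.Sum using (_⊎_; inj₁; inj₂)
open import Data.Product using (_×_; ∃-syntax; _,_)
open import Data.Empty using (⊥-elim)
open import Relation.Nullary using (¬_)
open import Relation.Binary.PropositionalEquality using (_≢_; refl; ≢-sym)

-- If w witnesses uv ∈ C_{1,2}(D) with, say, u → w, then w lies in v's part,
-- so v reaches w only by a path v → t → w with t ≠ u.  Now t lies in u's
-- part and t, u share the out-neighbour w, which makes them adjacent.

module _ {m n : ℕ} {D : BipTournament m n} where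

  Arc-irrefl : ∀ {x} → ¬ Arc D x x
  Arc-irrefl {inj₁ _} ()
  Arc-irrefl {inj₂ _} ()

  Arc⇒≢ : ∀ {x y} → Arc D x y → x ≢ y
  Arc⇒≢ x→x refl = Arc-irrefl x→x

  ¬Arc-fromBothParts : ∀ {a b w} → Arc D (inj₁ a) w → ¬ Arc D (inj₂ b) w
  ¬Arc-fromBothParts {w = inj₁ _} ()
  ¬Arc-fromBothParts {w = inj₂ _} _ ()

  Dist≤1⇒Arc : ∀ {z x y} → y ≢ x → Dist≤1 D z x y → Arc D x y
  Dist≤1⇒Arc y≢x (_ , _ , inj₁ refl) = ⊥-elim (y≢x refl)
  Dist≤1⇒Arc _   (_ , _ , inj₂ x→y)  = x→y

  Dist≤2⇒path₂ : ∀ {z x y} → y ≢ x → ¬ Arc D x y → Dist≤2 D z x y →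
                 ∃[ t ] (t ≢ z × Arc D x t × Arc D t y)
  Dist≤2⇒path₂ y≢x _    (inj₁ (_ , _ , inj₁ refl)) = ⊥-elim (y≢x refl)
  Dist≤2⇒path₂ _   ¬x→y (inj₁ (_ , _ , inj₂ x→y))  = ⊥-elim (¬x→y x→y)
  Dist≤2⇒path₂ _   _    (inj₂ (_ , _ , path))      = path

  commonOutNeighbour⇒C12Adj : ∀ {x y w} → x ≢ y → Arc D x w → Arc D y w → C12Adj D x y
  commonOutNeighbour⇒C12Adj {w = w} x≢y x→w y→w =
    x≢y , w , ≢-sym (Arc⇒≢ x→w) , ≢-sym (Arc⇒≢ y→w) ,
    inj₁ ( (x≢y , ≢-sym (Arc⇒≢ y→w) , inj₂ x→w)
         , inj₁ (≢-sym x≢y , ≢-sym (Arc⇒≢ x→w) , inj₂ y→w))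

  arcAndPath₂⇒C12Adj : ∀ {x y w} → Arc D x w → w ≢ y → ¬ Arc D y w → Dist≤2 D x y w →
                       ∃[ t ] (Arc D y t × C12Adj D x t)
  arcAndPath₂⇒C12Adj x→w w≢y ¬y→w y⇝w with Dist≤2⇒path₂ w≢y ¬y→w y⇝w
  ... | t , t≢x , y→t , t→w = t , y→t , commonOutNeighbour⇒C12Adj (≢-sym t≢x) x→w t→w

  outNeighbourOf₂ : ∀ {b} {P : Vtx m n → Set} → ∃[ t ] (Arc D (inj₂ b) t × P t) → ∃[ a ] P (inj₁ a)
  outNeighbourOf₂ (inj₁ a , _ , p) = a , p

  outNeighbourOf₁ : ∀ {a} {P : Vtx m n → Set} → ∃[ t ] (Arc D (inj₁ a) t × P t) → ∃[ b ] P (inj₂ b)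
  outNeighbourOf₁ (inj₂ b , _ , p) = b , p

lemma2p7 : (m n : ℕ) (D : BipTournament m n) (u : Fin m) (v : Fin n) →
    C12Adj D (inj₁ u) (inj₂ v) →
    (∃[ u′ ] C12Adj D (inj₁ u) (inj₁ u′)) ⊎ (∃[ v′ ] C12Adj D (inj₂ v) (inj₂ v′))
lemma2p7 m n D u v (_ , w , w≢u , w≢v , inj₁ (u↝w , v⇝w)) =
  let u→w = Dist≤1⇒Arc w≢u u↝w in
  inj₁ (outNeighbourOf₂ (arcAndPath₂⇒C12Adj u→w w≢v (¬Arc-fromBothParts u→w) v⇝w))
lemma2p7 m n D u v (_ , w , w≢u , w≢v , inj₂ (v↝w , u⇝w)) =
  let v→w = Dist≤1⇒Arc w≢v v↝w in
  inj₂ (outNeighbourOf₁ (arcAndPath₂⇒C12Adj v→w w≢u (λ u→w → ¬Arc-fromBothParts u→w v→w) u⇝w))
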